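{- For $n\ge 9$, $F(G_{3,3}^{(n)}) < F(R_{n-4,1}) < F(G_{3,2}^{(n)})$.
   Context: All graphs are finite and simple. The F-index of a graph $G$ is $F(G)=\sum_{v\in V(G)} d_G(v)^3$. Attaching a leaf to a vertex means adding a new vertex adjacent only to it. $G_{3,2}^{(n)}$ is obtained from a triangle by attaching $n-4$ leaves to one vertex $u$ and one leaf to another vertex of the triangle. $G_{3,3}^{(n)}$ is obtained from a triangle $xyz$ by attaching $n-5$ leaves to $x$ and $2$ leaves to $y$. $R_{k,1}$ ($k\ge1$) is obtained from a triangle $xyz$ by attaching $k$ pendant vertices to $z$ and then attaching one new leaf to one of these pendant vertices; it has $k+4$ vertices. -}

module Defs where

open import Data.Nat using (ℕ; zero; suc; _+_; _*_; _^_)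
open import Data.Bool using (Bool; true; false; _∨_; if_then_else_)
open import Data.Bool.Properties using (∨-comm)
open import Data.Fin using (Fin; toℕ)
open import Data.List using (List; map; allFin)
open import Data.Nat.ListAction using (sum)
open import Relation.Binary.PropositionalEquality using (_≡_; refl)

record SimpleGraph (n : ℕ) : Set where
  field
    adj    : Fin n → Fin n → Bool
    sym    : ∀ u v → adj u v ≡ adj v u
    irrefl : ∀ v → adj v v ≡ false
open SimpleGraph public

degree : ∀ {n} → SimpleGraph n → Fin n → ℕ
degree {n} G v = sum (map (λ w → if adj G v w then 1 else 0) (allFin n))

Findex : ∀ {n} → SimpleGraph n → ℕ
Findex {n} G = sum (map (λ v → degree G v ^ 3) (allFin n))

mkGraph : (n : ℕ) (e : ℕ → ℕ → Bool) → (∀ a → e a a ≡ false) → SimpleGraph n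
mkGraph n e irr = record
  { adj    = λ u v → e (toℕ u) (toℕ v) ∨ e (toℕ v) (toℕ u)
  ; sym    = λ u v → ∨-comm (e (toℕ u) (toℕ v)) (e (toℕ v) (toℕ u))
  ; irrefl = λ v → irrefl' (toℕ v)
  }
  where
  irrefl' : ∀ a → e a a ∨ e a a ≡ false
  irrefl' a rewrite irr a = refl

-- G_{3,2}^{(n)}: triangle u=0, v=1, w=2; leaf 3 attached to v;
-- leaves 4,…,n-1 (n-4 of them) attached to u.
e32 : ℕ → ℕ → Bool
e32 0 1 = true
e32 0 2 = true
e32 1 2 = true
e32 1 3 = true
e32 0 (suc (suc (suc (suc _)))) = true
e32 _ _ = false

e32-irr : ∀ a → e32 a a ≡ false
e32-irr 0 = refl
e32-irr 1 = refl
e32-irr (suc (suc a)) = refl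

G32 : (n : ℕ) → SimpleGraph n
G32 n = mkGraph n e32 e32-irr

-- G_{3,3}^{(n)}: triangle x=0, y=1, z=2; leaves 3,4 attached to y;
-- leaves 5,…,n-1 (n-5 of them) attached to x.
e33 : ℕ → ℕ → Bool
e33 0 1 = true
e33 0 2 = true
e33 1 2 = true
e33 1 3 = true
e33 1 4 = true
e33 0 (suc (suc (suc (suc (suc _))))) = true
e33 _ _ = false

e33-irr : ∀ a → e33 a a ≡ false
e33-irr 0 = refl
e33-irr 1 = refl
e33-irr (suc (suc a)) = refl

G33 : (n : ℕ) → SimpleGraph n
G33 n = mkGraph n e33 e33-irr

-- R_{k,1} on k+4 vertices: triangle x=0, y=1, z=2; pendant vertices
-- 4,…,k+3 (k of them) attached to z; new leaf 3 attached to pendant 4.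
eR : ℕ → ℕ → Bool
eR 0 1 = true
eR 0 2 = true
eR 1 2 = true
eR 2 (suc (suc (suc (suc _)))) = true
eR 3 4 = true
eR _ _ = false

eR-irr : ∀ a → eR a a ≡ false
eR-irr 0 = refl
eR-irr 1 = refl
eR-irr 2 = refl
eR-irr 3 = refl
eR-irr (suc (suc (suc (suc a)))) = refl

R : (k : ℕ) → SimpleGraph (k + 4)
R k = mkGraph (k + 4) eR eR-irr

-- All three graphs have one vertex carrying all but a bounded number of the
-- edges and otherwise bounded degrees, so each F-index is a cube plus a linear
-- term: F(G₃,₃) = (n-3)³ + n + 69, F(R_{n-4,1}) = (n-2)³ + n + 20 and
-- F(G₃,₂) = (n-2)³ + n + 32. The second gap is 12; the first is
-- 3(n-3)² + 3(n-3) - 48, already positive for n ≥ 7.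
module Submission where

open import Defs
open import Data.Nat using (ℕ; zero; suc; _+_; _*_; _^_; _≤_; _<_; _∸_; s≤s; z≤n)
open import Data.Nat.Properties
  using (+-comm; *-identityʳ; *-zeroʳ; m<m+n; m<n+m; +-monoʳ-<; +-commutativeSemigroup; module ≤-Reasoning)
open import Algebra.Properties.CommutativeSemigroup +-commutativeSemigroup using (x∙yz≈y∙xz)
open import Data.Nat.Solver using (module +-*-Solver)
open +-*-Solver using (solve; _:+_; _:*_; _:^_; _:=_; con)
open import Data.Bool using (Bool; _∨_; if_then_else_)
open import Data.Fin using (toℕ)
open import Data.List using (_∷_; map; allFin; tabulate; applyUpTo)
open import Data.List.Properties using (map-cong; map-tabulate)
open import Data.Nat.ListAction using (sum)
open import Data.Product using (_×_; _,_)
open import Function using (_∘_)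
open import Relation.Binary.PropositionalEquality using (_≡_; refl; cong; trans; module ≡-Reasoning)

tabulate-∘toℕ : ∀ {a} {A : Set a} n (f : ℕ → A) → tabulate {n = n} (f ∘ toℕ) ≡ applyUpTo f n
tabulate-∘toℕ zero    f = refl
tabulate-∘toℕ (suc n) f = cong (f 0 ∷_) (tabulate-∘toℕ n (f ∘ suc))

map-∘toℕ-allFin : ∀ {a} {A : Set a} n (f : ℕ → A) → map (f ∘ toℕ) (allFin n) ≡ applyUpTo f n
map-∘toℕ-allFin n f = trans (map-tabulate (λ i → i) (f ∘ toℕ)) (tabulate-∘toℕ n f)

sum-applyUpTo-const : ∀ c m → sum (applyUpTo (λ _ → c) m) ≡ m * c
sum-applyUpTo-const c zero    = refl
sum-applyUpTo-const c (suc m) = cong (c +_) (sum-applyUpTo-const c m)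

sum-zeros : ∀ m → sum (applyUpTo (λ _ → 0) m) ≡ 0
sum-zeros m = trans (sum-applyUpTo-const 0 m) (*-zeroʳ m)

sum-ones : ∀ m → sum (applyUpTo (λ _ → 1) m) ≡ m
sum-ones m = trans (sum-applyUpTo-const 1 m) (*-identityʳ m)

edgeIndicator : (ℕ → ℕ → Bool) → ℕ → ℕ → ℕ
edgeIndicator e a b = if e a b ∨ e b a then 1 else 0

Findex-mkGraph : ∀ n e irr (d : ℕ → ℕ) →
  (∀ a → sum (applyUpTo (edgeIndicator e a) n) ≡ d a) →
  Findex (mkGraph n e irr) ≡ sum (applyUpTo (λ a → d a ^ 3) n)
Findex-mkGraph n e irr d degree≡d = begin
  sum (map (λ v → degree (mkGraph n e irr) v ^ 3) (allFin n))
    ≡⟨ cong sum (map-cong (λ v → cong (_^ 3) (degree≡ v)) (allFin n)) ⟩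
  sum (map ((λ a → d a ^ 3) ∘ toℕ) (allFin n))
    ≡⟨ cong sum (map-∘toℕ-allFin n (λ a → d a ^ 3)) ⟩
  sum (applyUpTo (λ a → d a ^ 3) n) ∎
  where
  open ≡-Reasoning
  degree≡ : ∀ v → degree (mkGraph n e irr) v ≡ d (toℕ v)
  degree≡ v = trans (cong sum (map-∘toℕ-allFin n (edgeIndicator e (toℕ v)))) (degree≡d (toℕ v))

degrees-G33 : ℕ → ℕ → ℕ
degrees-G33 k 0 = 2 + k
degrees-G33 k 1 = 4
degrees-G33 k 2 = 2
degrees-G33 k _ = 1

degree-G33 : ∀ k a → sum (applyUpTo (edgeIndicator e33 a) (5 + k)) ≡ degrees-G33 k a
degree-G33 k 0                               = cong (2 +_) (sum-ones k)
degree-G33 k 1                               = cong (4 +_) (sum-zeros k)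
degree-G33 k 2                               = cong (2 +_) (sum-zeros k)
degree-G33 k 3                               = cong (1 +_) (sum-zeros k)
degree-G33 k 4                               = cong (1 +_) (sum-zeros k)
degree-G33 k (suc (suc (suc (suc (suc _))))) = cong (1 +_) (sum-zeros k)

Findex-G33 : ∀ k → Findex (G33 (5 + k)) ≡ (2 + k) ^ 3 + (74 + k)
Findex-G33 k = trans (Findex-mkGraph (5 + k) e33 e33-irr (degrees-G33 k) (degree-G33 k))
                     (cong (λ x → (2 + k) ^ 3 + (74 + x)) (sum-ones k))

degrees-G32 : ℕ → ℕ → ℕ
degrees-G32 k 0 = 2 + k
degrees-G32 k 1 = 3
degrees-G32 k 2 = 2
degrees-G32 k _ = 1

degree-G32 : ∀ k a → sum (applyUpTo (edgeIndicator e32 a) (4 + k)) ≡ degrees-G32 k a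
degree-G32 k 0                         = cong (2 +_) (sum-ones k)
degree-G32 k 1                         = cong (3 +_) (sum-zeros k)
degree-G32 k 2                         = cong (2 +_) (sum-zeros k)
degree-G32 k 3                         = cong (1 +_) (sum-zeros k)
degree-G32 k (suc (suc (suc (suc _)))) = cong (1 +_) (sum-zeros k)

Findex-G32 : ∀ k → Findex (G32 (4 + k)) ≡ (2 + k) ^ 3 + (36 + k)
Findex-G32 k = trans (Findex-mkGraph (4 + k) e32 e32-irr (degrees-G32 k) (degree-G32 k))
                     (cong (λ x → (2 + k) ^ 3 + (36 + x)) (sum-ones k))

degrees-R : ℕ → ℕ → ℕ
degrees-R j 0 = 2
degrees-R j 1 = 2
degrees-R j 2 = 3 + j
degrees-R j 3 = 1
degrees-R j 4 = 2
degrees-R j _ = 1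

-- R k has k + 4 vertices; sums over that range only compute once the
-- count is rewritten to start with a numeral.
vertices-R : ∀ j → 1 + j + 4 ≡ 5 + j
vertices-R j = +-comm (1 + j) 4

degree-R : ∀ j a → sum (applyUpTo (edgeIndicator eR a) (1 + j + 4)) ≡ degrees-R j a
degree-R j a = trans (cong (sum ∘ applyUpTo (edgeIndicator eR a)) (vertices-R j)) (degree′ a)
  where
  degree′ : ∀ a → sum (applyUpTo (edgeIndicator eR a) (5 + j)) ≡ degrees-R j a
  degree′ 0                               = cong (2 +_) (sum-zeros j)
  degree′ 1                               = cong (2 +_) (sum-zeros j)
  degree′ 2                               = cong (3 +_) (sum-ones j)
  degree′ 3                               = cong (1 +_) (sum-zeros j)
  degree′ 4                               = cong (2 +_) (sum-zeros j)
  degree′ (suc (suc (suc (suc (suc _))))) = cong (1 +_) (sum-zeros j)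

Findex-R : ∀ j → Findex (R (1 + j)) ≡ (3 + j) ^ 3 + (25 + j)
Findex-R j = begin
  Findex (R (1 + j))
    ≡⟨ Findex-mkGraph (1 + j + 4) eR eR-irr (degrees-R j) (degree-R j) ⟩
  sum (applyUpTo (λ a → degrees-R j a ^ 3) (1 + j + 4))
    ≡⟨ cong (sum ∘ applyUpTo (λ a → degrees-R j a ^ 3)) (vertices-R j) ⟩
  sum (applyUpTo (λ a → degrees-R j a ^ 3) (5 + j))
    ≡⟨ cong (λ x → 16 + ((3 + j) ^ 3 + (9 + x))) (sum-ones j) ⟩
  16 + ((3 + j) ^ 3 + (9 + j))
    ≡⟨ x∙yz≈y∙xz 16 ((3 + j) ^ 3) (9 + j) ⟩
  (3 + j) ^ 3 + (25 + j) ∎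
  where open ≡-Reasoning

cube-difference : ∀ k → (5 + k) ^ 3 + (27 + k) ≡ (4 + k) ^ 3 + (76 + k) + (1 + (3 * k * k + 27 * k + 11))
cube-difference = solve 1 (λ k →
  (con 5 :+ k) :^ 3 :+ (con 27 :+ k)
    := (con 4 :+ k) :^ 3 :+ (con 76 :+ k) :+ (con 1 :+ (con 3 :* k :* k :+ con 27 :* k :+ con 11))) refl

Findex-G33<Findex-R : ∀ k → Findex (G33 (7 + k)) < Findex (R (3 + k))
Findex-G33<Findex-R k = begin-strict
  Findex (G33 (7 + k))
    ≡⟨ Findex-G33 (2 + k) ⟩
  (4 + k) ^ 3 + (76 + k)
    <⟨ m<m+n _ (s≤s z≤n) ⟩
  (4 + k) ^ 3 + (76 + k) + (1 + (3 * k * k + 27 * k + 11))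
    ≡⟨ cube-difference k ⟨
  (5 + k) ^ 3 + (27 + k)
    ≡⟨ Findex-R (2 + k) ⟨
  Findex (R (3 + k)) ∎
  where open ≤-Reasoning

Findex-R<Findex-G32 : ∀ j → Findex (R (1 + j)) < Findex (G32 (5 + j))
Findex-R<Findex-G32 j = begin-strict
  Findex (R (1 + j))     ≡⟨ Findex-R j ⟩
  (3 + j) ^ 3 + (25 + j) <⟨ +-monoʳ-< ((3 + j) ^ 3) (m<n+m (25 + j) {12} (s≤s z≤n)) ⟩
  (3 + j) ^ 3 + (37 + j) ≡⟨ Findex-G32 (1 + j) ⟨
  Findex (G32 (5 + j))   ∎
  where open ≤-Reasoning

theorem8 : (n : ℕ) → 9 ≤ n →
    (Findex (G33 n) < Findex (R (n ∸ 4))) × (Findex (R (n ∸ 4)) < Findex (G32 n))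
theorem8 (suc (suc (suc (suc (suc (suc (suc (suc (suc m))))))))) (s≤s (s≤s (s≤s (s≤s (s≤s (s≤s (s≤s (s≤s (s≤s z≤n))))))))) =
  Findex-G33<Findex-R (2 + m) , Findex-R<Findex-G32 (4 + m)
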